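{- Let $x_1,x_2,\ldots,x_m$ be arbitrary positive integers. Then \[ ES(x_1,\ldots,x_m)\le 2^{m}\left(\frac{(2m-1)!!}{(2m)!!}\right)^{1/2}=\left(2\binom{2m-1}{m}\right)^{1/2}. \] In particular, for every positive integer $m$, \[ J_m\le \left(2\binom{2m+1}{m+1}\right)^{1/2}. \]
   Context: For positive integers $x_1,\ldots,x_m$, $ES(x_1,\ldots,x_m)$ denotes the number of sign vectors $(\varepsilon_1,\ldots,\varepsilon_m)\in\{ -1,1\}^m$ with $\sum_{i=1}^m \varepsilon_i x_i=0$. For a positive integer $k$, $k!!$ denotes the product of all positive integers $\le k$ having the same parity as $k$. For a positive integer $n$, $J_n$ denotes the number of $(\delta_0,\ldots,\delta_n)\in\{ -1,1\}^{n+1}$ with $\sum_{i=0}^{n}\delta_i\binom{n}{i}=0$. -}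

module Defs where

open import Data.Nat using (ℕ; zero; suc; _+_; _*_)
open import Data.Nat.Combinatorics using (_C_)
open import Data.Integer as ℤ using (ℤ; +_)
open import Data.Fin using (Fin; toℕ)
import Data.Fin as Fin
open import Data.List using (List; []; _∷_; map; _++_; length; filter)
open import Data.Vec using (Vec; []; _∷_)
open import Relation.Nullary.Decidable using (Dec)
open import Relation.Binary.PropositionalEquality using (_≡_)

data Sign : Set where
  plus minus : Sign

signValue : Sign → ℤ
signValue plus  = + 1
signValue minus = ℤ.- (+ 1)

allSigns : (m : ℕ) → List (Vec Sign m)
allSigns zero    = [] ∷ []
allSigns (suc m) = map (plus ∷_) (allSigns m) ++ map (minus ∷_) (allSigns m)

signedSum : {m : ℕ} → Vec Sign m → (Fin m → ℕ) → ℤ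
signedSum []       x = + 0
signedSum (e ∷ es) x = signValue e ℤ.* (+ x Fin.zero) ℤ.+ signedSum es (λ i → x (Fin.suc i))

ES : (m : ℕ) → (Fin m → ℕ) → ℕ
ES m x = length (filter (λ ε → signedSum ε x ℤ.≟ + 0) (allSigns m))

_!! : ℕ → ℕ
zero !!          = 1
suc zero !!      = 1
suc (suc k) !!   = suc (suc k) * (k !!)

J : ℕ → ℕ
J n = ES (suc n) (λ i → n C toℕ i)

-- Concatenating two balanced sign vectors (signed sum 0) of x gives one of the doubled sequence x x,
-- so ES(x)² ≤ ES(x x). For positive weights the signed sum strictly increases along every
-- chain of the Boolean lattice {-1,1}^n, so a symmetric chain decomposition (de Bruijn et al.)
-- shows that at most C(n, ⌊n/2⌋) sign vectors are balanced (Erdős' Littlewood–Offord bound).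
-- With n = 2m this gives ES(x)² ≤ C(2m, m) = 2 C(2m-1, m) = 4^m (2m-1)!!/(2m)!!.
module Submission where

open import Defs
open import Data.Nat using (ℕ; _*_; _∸_; _^_; _≤_; _<_; _+_)
open import Data.Nat.Combinatorics using (_C_)
open import Data.Fin using (Fin; toℕ)
open import Data.Product using (_×_)
open import Relation.Binary.PropositionalEquality using (_≡_)

open import Data.Nat as ℕ using (zero; suc; z≤n; s≤s; ⌊_/2⌋; _!; NonZero)
open import Data.Nat.Properties
open import Algebra.Properties.CommutativeSemigroup +-commutativeSemigroup using (interchange)
open import Data.Nat.Combinatorics
  using (nCk≡n!/k![n-k]!; k![n∸k]!∣n!; nCk≡nC[n∸k]; nCk+nC[k+1]≡[n+1]C[k+1])
open import Data.Nat.DivMod using (m/n*n≡m)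
open import Data.Nat.ListAction using (sum)
open import Data.Nat.ListAction.Properties using (sum-++)
open import Data.Nat.Tactic.RingSolver using (solve-∀)
open import Data.Integer as ℤ using (ℤ)
import Data.Integer.Properties as ℤₚ
import Data.Fin as Fin
open import Data.Fin.Properties using (toℕ≤pred[n])
open import Data.Vec.Functional using (Vector; tail) renaming (_++_ to _++ᶠ_)
import Data.Vec.Functional.Relation.Unary.All.Properties as Allᶠ
open import Data.List using (List; []; _∷_; [_]; map; _++_; length; filter; concatMap)
open import Data.List.Properties using (map-++; map-∘; map-cong)
open import Data.List.Relation.Unary.All as All using (All; []; _∷_)
open import Data.List.Relation.Unary.All.Properties using (++⁺)
open import Data.Vec as Vec using (Vec; []; _∷_)
open import Data.Product using (∃; _,_)
open import Data.Sum using (inj₁; inj₂)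
open import Function using (_∘_)
open import Relation.Nullary.Decidable using (Dec; yes; no)
open import Relation.Nullary.Negation using (contradiction)
open import Relation.Binary.PropositionalEquality
  using (_≗_; refl; sym; trans; cong; cong₂; subst; subst₂; module ≡-Reasoning)

private variable
  A B : Set
  n k : ℕ

𝟙 : {P : Set} → Dec P → ℕ
𝟙 (yes _) = 1
𝟙 (no _)  = 0

𝟙-cong : {P Q : Set} → (P → Q) → (Q → P) → (P? : Dec P) (Q? : Dec Q) → 𝟙 P? ≡ 𝟙 Q?
𝟙-cong P→Q Q→P (yes _) (yes _) = refl
𝟙-cong P→Q Q→P (no _)  (no _)  = refl
𝟙-cong P→Q Q→P (yes p) (no ¬q) = contradiction (P→Q p) ¬q
𝟙-cong P→Q Q→P (no ¬p) (yes q) = contradiction (Q→P q) ¬p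

total : (A → ℕ) → List A → ℕ
total f xs = sum (map f xs)

total-++ : (f : A → ℕ) (xs ys : List A) → total f (xs ++ ys) ≡ total f xs + total f ys
total-++ f xs ys = trans (cong sum (map-++ f xs ys)) (sum-++ (map f xs) (map f ys))

total-map : (f : B → ℕ) (g : A → B) (xs : List A) → total f (map g xs) ≡ total (f ∘ g) xs
total-map f g xs = cong sum (sym (map-∘ xs))

total-cong : {f g : A → ℕ} → f ≗ g → (xs : List A) → total f xs ≡ total g xs
total-cong f≗g xs = cong sum (map-cong f≗g xs)

total-+ : (f g : A → ℕ) (xs : List A) → total (λ a → f a + g a) xs ≡ total f xs + total g xs
total-+ f g []       = refl
total-+ f g (x ∷ xs) = begin
  (f x + g x) + total (λ a → f a + g a) xs ≡⟨ cong ((f x + g x) +_) (total-+ f g xs) ⟩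
  (f x + g x) + (total f xs + total g xs)  ≡⟨ interchange (f x) (g x) (total f xs) (total g xs) ⟩
  (f x + total f xs) + (g x + total g xs)  ∎
  where open ≡-Reasoning

total-*ʳ : (f : A → ℕ) (c : ℕ) (xs : List A) → total (λ a → f a * c) xs ≡ total f xs * c
total-*ʳ f c []       = refl
total-*ʳ f c (x ∷ xs) =
  trans (cong (f x * c +_) (total-*ʳ f c xs)) (sym (*-distribʳ-+ c (f x) (total f xs)))

total-concatMap : (f : B → ℕ) (g : A → List B) (xs : List A) →
                  total f (concatMap g xs) ≡ total (total f ∘ g) xs
total-concatMap f g []       = refl
total-concatMap f g (x ∷ xs) =
  trans (total-++ f (g x) (concatMap g xs)) (cong (total f (g x) +_) (total-concatMap f g xs))

total-mono : {f g : A → ℕ} {xs : List A} → All (λ a → f a ≤ g a) xs → total f xs ≤ total g xs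
total-mono []           = z≤n
total-mono (fx≤gx ∷ le) = +-mono-≤ fx≤gx (total-mono le)

length-filter≡total : {P : A → Set} (P? : ∀ a → Dec (P a)) (xs : List A) →
                      length (filter P? xs) ≡ total (𝟙 ∘ P?) xs
length-filter≡total P? []       = refl
length-filter≡total P? (x ∷ xs) with P? x
... | yes _ = cong suc (length-filter≡total P? xs)
... | no _  = length-filter≡total P? xs

total-allSigns-suc : (f : Vec Sign (suc n) → ℕ) →
  total f (allSigns (suc n)) ≡ total (f ∘ (plus ∷_)) (allSigns n) + total (f ∘ (minus ∷_)) (allSigns n)
total-allSigns-suc {n} f = trans (total-++ f (map (plus ∷_) (allSigns n)) _)
  (cong₂ _+_ (total-map f (plus ∷_) (allSigns n)) (total-map f (minus ∷_) (allSigns n)))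

total-allSigns-+ : ∀ a {b} (f : Vec Sign (a + b) → ℕ) →
  total f (allSigns (a + b)) ≡ total (λ u → total (λ w → f (u Vec.++ w)) (allSigns b)) (allSigns a)
total-allSigns-+ zero    f = sym (+-identityʳ _)
total-allSigns-+ (suc a) f = begin
  total f (allSigns (suc a + _))
    ≡⟨ total-allSigns-suc f ⟩
  total (f ∘ (plus ∷_)) (allSigns (a + _)) + total (f ∘ (minus ∷_)) (allSigns (a + _))
    ≡⟨ cong₂ _+_ (total-allSigns-+ a _) (total-allSigns-+ a _) ⟩
  total (g ∘ (plus ∷_)) (allSigns a) + total (g ∘ (minus ∷_)) (allSigns a)
    ≡⟨ sym (total-allSigns-suc g) ⟩
  total g (allSigns (suc a)) ∎
  where
  open ≡-Reasoning
  g : Vec Sign (suc a) → ℕ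
  g u = total (λ w → f (u Vec.++ w)) (allSigns _)

𝟙-balanced : (Fin n → ℕ) → Vec Sign n → ℕ
𝟙-balanced x ε = 𝟙 (signedSum ε x ℤ.≟ ℤ.+ 0)

ES≡total : ∀ n (x : Fin n → ℕ) → ES n x ≡ total (𝟙-balanced x) (allSigns n)
ES≡total n x = length-filter≡total (λ ε → signedSum ε x ℤ.≟ ℤ.+ 0) (allSigns n)

-- Doubling

signedSum-cong : (ε : Vec Sign n) {x y : Fin n → ℕ} → x ≗ y → signedSum ε x ≡ signedSum ε y
signedSum-cong []      x≗y = refl
signedSum-cong (e ∷ ε) x≗y =
  cong₂ (λ a s → signValue e ℤ.* ℤ.+ a ℤ.+ s) (x≗y Fin.zero) (signedSum-cong ε (x≗y ∘ Fin.suc))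

tail-++ᶠ : ∀ {m} (x : Vector A (suc m)) (y : Vector A n) → tail (x ++ᶠ y) ≗ tail x ++ᶠ y
tail-++ᶠ {m = m} x y i with Fin.splitAt m i
... | inj₁ _ = refl
... | inj₂ _ = refl

signedSum-++ : ∀ {m} (ε : Vec Sign m) (δ : Vec Sign n) (x : Fin m → ℕ) (y : Fin n → ℕ) →
               signedSum (ε Vec.++ δ) (x ++ᶠ y) ≡ signedSum ε x ℤ.+ signedSum δ y
signedSum-++ []      δ x y = sym (ℤₚ.+-identityˡ _)
signedSum-++ (e ∷ ε) δ x y = begin
  head ℤ.+ signedSum (ε Vec.++ δ) (tail (x ++ᶠ y))
    ≡⟨ cong (ℤ._+_ head) (signedSum-cong (ε Vec.++ δ) (tail-++ᶠ x y)) ⟩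
  head ℤ.+ signedSum (ε Vec.++ δ) (tail x ++ᶠ y)
    ≡⟨ cong (ℤ._+_ head) (signedSum-++ ε δ (tail x) y) ⟩
  head ℤ.+ (signedSum ε (tail x) ℤ.+ signedSum δ y)
    ≡⟨ ℤₚ.+-assoc head _ _ ⟨
  head ℤ.+ signedSum ε (tail x) ℤ.+ signedSum δ y ∎
  where
  open ≡-Reasoning
  head = signValue e ℤ.* ℤ.+ x Fin.zero

ES-*-≤-ES-++ : ∀ {m} (x : Fin m → ℕ) (y : Fin n → ℕ) → ES m x * ES n y ≤ ES (m + n) (x ++ᶠ y)
ES-*-≤-ES-++ {n} {m} x y = begin
  ES m x * ES n y
    ≡⟨ cong₂ _*_ (ES≡total m x) (ES≡total n y) ⟩
  total (𝟙-balanced x) (allSigns m) * total (𝟙-balanced y) (allSigns n)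
    ≡⟨ sym (total-*ʳ (𝟙-balanced x) _ (allSigns m)) ⟩
  total (λ ε → 𝟙-balanced x ε * total (𝟙-balanced y) (allSigns n)) (allSigns m)
    ≤⟨ total-mono (All.universal extend-balanced (allSigns m)) ⟩
  total (λ ε → total (λ δ → 𝟙-balanced (x ++ᶠ y) (ε Vec.++ δ)) (allSigns n)) (allSigns m)
    ≡⟨ sym (total-allSigns-+ m (𝟙-balanced (x ++ᶠ y))) ⟩
  total (𝟙-balanced (x ++ᶠ y)) (allSigns (m + n))
    ≡⟨ sym (ES≡total (m + n) (x ++ᶠ y)) ⟩
  ES (m + n) (x ++ᶠ y) ∎
  where
  open ≤-Reasoning
  extend-balanced : ∀ ε → 𝟙-balanced x ε * total (𝟙-balanced y) (allSigns n)
                        ≤ total (λ δ → 𝟙-balanced (x ++ᶠ y) (ε Vec.++ δ)) (allSigns n)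
  extend-balanced ε with signedSum ε x ℤ.≟ ℤ.+ 0
  ... | no _          = z≤n
  ... | yes ε-balanced = ≤-reflexive (trans (+-identityʳ _) (sym (total-cong balanced-++ (allSigns n))))
    where
    balanced-++ : ∀ δ → 𝟙-balanced (x ++ᶠ y) (ε Vec.++ δ) ≡ 𝟙-balanced y δ
    balanced-++ δ = cong (λ s → 𝟙 (s ℤ.≟ ℤ.+ 0)) (trans (signedSum-++ ε δ x y)
      (trans (cong (ℤ._+ signedSum δ y) ε-balanced) (ℤₚ.+-identityˡ (signedSum δ y))))

-- Symmetric chains

rank : Vec Sign n → ℕ
rank []          = 0
rank (plus ∷ ε)  = suc (rank ε)
rank (minus ∷ ε) = rank ε

data _⋖_ : Vec Sign n → Vec Sign n → Set where
  here  : {ε : Vec Sign n} → (minus ∷ ε) ⋖ (plus ∷ ε)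
  there : {e : Sign} {ε δ : Vec Sign n} → ε ⋖ δ → (e ∷ ε) ⋖ (e ∷ δ)

rank-⋖ : {ε δ : Vec Sign n} → ε ⋖ δ → rank δ ≡ suc (rank ε)
rank-⋖ here                 = refl
rank-⋖ (there {e = plus} p)  = cong suc (rank-⋖ p)
rank-⋖ (there {e = minus} p) = rank-⋖ p

data CoverChain {n : ℕ} : ℕ → Vec Sign n → List (Vec Sign n) → Set where
  []  : {ε : Vec Sign n} → CoverChain 0 ε []
  _◅_ : {ε δ : Vec Sign n} {δs : List (Vec Sign n)} →
        ε ⋖ δ → CoverChain k δ δs → CoverChain (suc k) ε (δ ∷ δs)

Chain : ℕ → Set
Chain n = Vec Sign n × List (Vec Sign n)

elements : Chain n → List (Vec Sign n)
elements (ε , δs) = ε ∷ δs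

SymmetricChain : ∀ n → Chain n → Set
SymmetricChain n (ε , δs) = ∃ λ k → CoverChain k ε δs × rank ε + rank ε + k ≡ n

-- A chain ε₀ ⋖ … ⋖ εₖ splits into  -ε₀ ⋖ … ⋖ -εₖ ⋖ +εₖ  and  +ε₀ ⋖ … ⋖ +εₖ₋₁.
lengthen : Vec Sign n → List (Vec Sign n) → List (Vec Sign (suc n))
lengthen ε []       = [ plus ∷ ε ]
lengthen ε (δ ∷ δs) = (minus ∷ δ) ∷ lengthen δ δs

shorten : Vec Sign n → List (Vec Sign n) → List (Vec Sign (suc n))
shorten ε []       = []
shorten ε (δ ∷ δs) = (plus ∷ ε) ∷ shorten δ δs

split : Chain n → List (Chain (suc n))
split (ε , [])     = (minus ∷ ε , lengthen ε []) ∷ []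
split (ε , δ ∷ δs) = (minus ∷ ε , lengthen ε (δ ∷ δs)) ∷ (plus ∷ ε , shorten δ δs) ∷ []

symmetricChains : ∀ n → List (Chain n)
symmetricChains zero    = ([] , []) ∷ []
symmetricChains (suc n) = concatMap split (symmetricChains n)

total-lengthen-shorten : (f : Vec Sign (suc n) → ℕ) (ε : Vec Sign n) (δs : List (Vec Sign n)) →
  total f (lengthen ε δs) + total f (shorten ε δs)
    ≡ total (f ∘ (minus ∷_)) δs + total (f ∘ (plus ∷_)) (ε ∷ δs)
total-lengthen-shorten f ε []       = +-identityʳ _
total-lengthen-shorten f ε (δ ∷ δs) = begin
  (f (minus ∷ δ) + L) + (f (plus ∷ ε) + S) ≡⟨ interchange (f (minus ∷ δ)) L (f (plus ∷ ε)) S ⟩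
  (f (minus ∷ δ) + f (plus ∷ ε)) + (L + S) ≡⟨ cong ((f (minus ∷ δ) + f (plus ∷ ε)) +_) (total-lengthen-shorten f δ δs) ⟩
  (f (minus ∷ δ) + f (plus ∷ ε)) + (M + P) ≡⟨ interchange (f (minus ∷ δ)) (f (plus ∷ ε)) M P ⟩
  (f (minus ∷ δ) + M) + (f (plus ∷ ε) + P) ∎
  where
  open ≡-Reasoning
  L = total f (lengthen δ δs)
  S = total f (shorten δ δs)
  M = total (f ∘ (minus ∷_)) δs
  P = total (f ∘ (plus ∷_)) (δ ∷ δs)

total-split : (f : Vec Sign (suc n) → ℕ) (c : Chain n) →
  total (total f ∘ elements) (split c) ≡ total (f ∘ (minus ∷_)) (elements c) + total (f ∘ (plus ∷_)) (elements c)
total-split f (ε , []) = identities (f (minus ∷ ε)) (f (plus ∷ ε))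
  where
  identities : ∀ a b → (a + (b + 0)) + 0 ≡ (a + 0) + (b + 0)
  identities = solve-∀
total-split f (ε , δ ∷ δs) = begin
  (a + L) + (S + 0)  ≡⟨ cong ((a + L) +_) (+-identityʳ S) ⟩
  (a + L) + S        ≡⟨ +-assoc a L S ⟩
  a + (L + S)        ≡⟨ cong (a +_) (total-lengthen-shorten f ε (δ ∷ δs)) ⟩
  a + (M + P)        ≡⟨ sym (+-assoc a M P) ⟩
  (a + M) + P        ∎
  where
  open ≡-Reasoning
  a = f (minus ∷ ε)
  L = total f (lengthen ε (δ ∷ δs))
  S = total f (shorten ε (δ ∷ δs))
  M = total (f ∘ (minus ∷_)) (δ ∷ δs)
  P = total (f ∘ (plus ∷_)) (ε ∷ δ ∷ δs)

total-symmetricChains : ∀ n (f : Vec Sign n → ℕ) →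
  total f (allSigns n) ≡ total (total f ∘ elements) (symmetricChains n)
total-symmetricChains zero    f = cong (_+ 0) (sym (+-identityʳ _))
total-symmetricChains (suc n) f = begin
  total f (allSigns (suc n))
    ≡⟨ trans (total-allSigns-suc f) (+-comm (total (f ∘ (plus ∷_)) (allSigns n)) _) ⟩
  total (f ∘ (minus ∷_)) (allSigns n) + total (f ∘ (plus ∷_)) (allSigns n)
    ≡⟨ cong₂ _+_ (total-symmetricChains n _) (total-symmetricChains n _) ⟩
  total (total (f ∘ (minus ∷_)) ∘ elements) cs + total (total (f ∘ (plus ∷_)) ∘ elements) cs
    ≡⟨ sym (total-+ _ _ cs) ⟩
  total (λ c → total (f ∘ (minus ∷_)) (elements c) + total (f ∘ (plus ∷_)) (elements c)) cs
    ≡⟨ sym (total-cong (total-split f) cs) ⟩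
  total (total (total f ∘ elements) ∘ split) cs
    ≡⟨ sym (total-concatMap (total f ∘ elements) split cs) ⟩
  total (total f ∘ elements) (symmetricChains (suc n)) ∎
  where
  open ≡-Reasoning
  cs = symmetricChains n

lengthen-coverChain : {ε : Vec Sign n} {δs : List (Vec Sign n)} →
  CoverChain k ε δs → CoverChain (suc k) (minus ∷ ε) (lengthen ε δs)
lengthen-coverChain []      = here ◅ []
lengthen-coverChain (p ◅ c) = there p ◅ lengthen-coverChain c

shorten-coverChain : {ε δ : Vec Sign n} {δs : List (Vec Sign n)} →
  ε ⋖ δ → CoverChain k δ δs → CoverChain k (plus ∷ ε) (shorten δ δs)
shorten-coverChain p []      = []
shorten-coverChain p (q ◅ c) = there p ◅ shorten-coverChain q c

split-symmetric : (c : Chain n) → SymmetricChain n c → All (SymmetricChain (suc n)) (split c)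
split-symmetric (ε , []) (k , c , r+r+k≡n) =
  (suc k , lengthen-coverChain c , trans (+-suc _ k) (cong suc r+r+k≡n)) ∷ []
split-symmetric {n} (ε , δ ∷ δs) (suc k , p ◅ c , r+r+k≡n) =
  (suc (suc k) , lengthen-coverChain (p ◅ c) , trans (+-suc _ (suc k)) (cong suc r+r+k≡n))
  ∷ (k , shorten-coverChain p c , shorter-symmetric) ∷ []
  where
  r = rank ε
  shorter-symmetric : suc r + suc r + k ≡ suc n
  shorter-symmetric = trans (cong (λ s → suc (s + k)) (+-suc r r))
    (trans (cong suc (sym (+-suc (r + r) k))) (cong suc r+r+k≡n))

symmetricChains-symmetric : ∀ n → All (SymmetricChain n) (symmetricChains n)
symmetricChains-symmetric zero    = (0 , [] , refl) ∷ []
symmetricChains-symmetric (suc n) = concat-split (symmetricChains n) (symmetricChains-symmetric n)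
  where
  concat-split : (cs : List (Chain n)) → All (SymmetricChain n) cs →
                 All (SymmetricChain (suc n)) (concatMap split cs)
  concat-split []       []       = []
  concat-split (c ∷ cs) (s ∷ ss) = ++⁺ (split-symmetric c s) (concat-split cs ss)

-- Littlewood–Offord

module _ (g : Vec Sign n → ℤ) (g-⋖ : ∀ {ε δ} → ε ⋖ δ → g ε ℤ.< g δ) (t : ℤ) where

  no-hits-above : {ε : Vec Sign n} {δs : List (Vec Sign n)} →
    CoverChain k ε δs → t ℤ.< g ε → total (λ u → 𝟙 (g u ℤ.≟ t)) (ε ∷ δs) ≡ 0
  no-hits-above {ε = ε} c t<gε with g ε ℤ.≟ t
  no-hits-above         c       t<gε | yes gε≡t = contradiction t<gε (ℤₚ.<-irrefl (sym gε≡t))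
  no-hits-above         []      t<gε | no _ = refl
  no-hits-above         (p ◅ c) t<gε | no _ = no-hits-above c (ℤₚ.<-trans t<gε (g-⋖ p))

  hits-≤1 : {ε : Vec Sign n} {δs : List (Vec Sign n)} →
    CoverChain k ε δs → total (λ u → 𝟙 (g u ℤ.≟ t)) (ε ∷ δs) ≤ 1
  hits-≤1 {ε = ε} c with g ε ℤ.≟ t
  hits-≤1         []      | yes _    = ≤-refl
  hits-≤1         (p ◅ c) | yes gε≡t =
    ≤-reflexive (cong suc (no-hits-above c (subst (ℤ._< _) gε≡t (g-⋖ p))))
  hits-≤1         []      | no _     = z≤n
  hits-≤1         (p ◅ c) | no _     = hits-≤1 c

𝟙-rank : ℕ → Vec Sign n → ℕ
𝟙-rank j ε = 𝟙 (rank ε ℕ.≟ j)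

rank-hits-between : ∀ j {ε : Vec Sign n} {δs : List (Vec Sign n)} →
  CoverChain k ε δs → rank ε ≤ j → j ≤ rank ε + k → 1 ≤ total (𝟙-rank j) (ε ∷ δs)
rank-hits-between j {ε} c r≤j j≤r+k with rank ε ℕ.≟ j
... | yes _ = s≤s z≤n
rank-hits-between j {ε} [] r≤j j≤r+k | no r≢j =
  contradiction (≤-antisym r≤j (subst (j ≤_) (+-identityʳ _) j≤r+k)) r≢j
rank-hits-between j {ε} (_◅_ {k = k} p c) r≤j j≤r+k | no r≢j = rank-hits-between j c
  (subst (_≤ j) (sym (rank-⋖ p)) (≤∧≢⇒< r≤j r≢j))
  (subst (j ≤_) (trans (+-suc (rank ε) k) (cong (_+ k) (sym (rank-⋖ p)))) j≤r+k)

⌊r+r+k/2⌋≡r+⌊k/2⌋ : ∀ r k → ⌊ r + r + k /2⌋ ≡ r + ⌊ k /2⌋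
⌊r+r+k/2⌋≡r+⌊k/2⌋ zero    k = refl
⌊r+r+k/2⌋≡r+⌊k/2⌋ (suc r) k =
  trans (cong (λ s → ⌊ suc (s + k) /2⌋) (+-suc r r)) (cong suc (⌊r+r+k/2⌋≡r+⌊k/2⌋ r k))

symmetricChain-meets-middle : (c : Chain n) → SymmetricChain n c → 1 ≤ total (𝟙-rank ⌊ n /2⌋) (elements c)
symmetricChain-meets-middle {n} (ε , δs) (k , c , r+r+k≡n) = rank-hits-between ⌊ n /2⌋ c
  (subst (r ≤_) (sym middle) (m≤m+n r _))
  (subst (_≤ r + k) (sym middle) (+-monoʳ-≤ r (⌊n/2⌋≤n k)))
  where
  r = rank ε
  middle : ⌊ n /2⌋ ≡ r + ⌊ k /2⌋
  middle = trans (cong ⌊_/2⌋ (sym r+r+k≡n)) (⌊r+r+k/2⌋≡r+⌊k/2⌋ r k)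

𝟙-rank-plus : ∀ j (ε : Vec Sign n) → 𝟙-rank (suc j) (plus ∷ ε) ≡ 𝟙-rank j ε
𝟙-rank-plus j ε = 𝟙-cong suc-injective (cong suc) (suc (rank ε) ℕ.≟ suc j) (rank ε ℕ.≟ j)

total-𝟙-rank : ∀ n j → total (𝟙-rank j) (allSigns n) ≡ n C j
total-𝟙-rank zero    zero    = refl
total-𝟙-rank zero    (suc j) = refl
total-𝟙-rank (suc n) j = trans (total-allSigns-suc {n} (𝟙-rank j)) (pascal j)
  where
  pascal : ∀ j → total (𝟙-rank j ∘ (plus ∷_)) (allSigns n) + total (𝟙-rank j) (allSigns n) ≡ suc n C j
  pascal zero    = trans (cong (_+ total (𝟙-rank 0) (allSigns n)) (total-zero (allSigns n))) (total-𝟙-rank n 0)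
    where
    total-zero : (xs : List (Vec Sign n)) → total (𝟙-rank 0 ∘ (plus ∷_)) xs ≡ 0
    total-zero []       = refl
    total-zero (_ ∷ xs) = total-zero xs
  pascal (suc j) = trans (cong₂ _+_ (trans (total-cong (𝟙-rank-plus j) (allSigns n)) (total-𝟙-rank n j))
                                     (total-𝟙-rank n (suc j)))
                         (nCk+nC[k+1]≡[n+1]C[k+1] n j)

signedSum-⋖ : (x : Fin n → ℕ) → (∀ i → 0 < x i) → {ε δ : Vec Sign n} → ε ⋖ δ →
              signedSum ε x ℤ.< signedSum δ x
signedSum-⋖ x pos {minus ∷ ε} here with x Fin.zero | pos Fin.zero
... | suc a | _ = ℤₚ.+-monoˡ-< (signedSum ε (tail x))
  (subst₂ ℤ._<_ (sym (ℤₚ.-1*i≡-i (ℤ.+ suc a))) (sym (ℤₚ.*-identityˡ (ℤ.+ suc a))) ℤ.-<+)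
signedSum-⋖ x pos (there {e = e} p) =
  ℤₚ.+-monoʳ-< (signValue e ℤ.* ℤ.+ x Fin.zero) (signedSum-⋖ (tail x) (pos ∘ Fin.suc) p)

littlewood-offord : ∀ n (x : Fin n → ℕ) → (∀ i → 0 < x i) → ES n x ≤ n C ⌊ n /2⌋
littlewood-offord n x pos = begin
  ES n x                                                                  ≡⟨ ES≡total n x ⟩
  total (𝟙-balanced x) (allSigns n)                                       ≡⟨ total-symmetricChains n _ ⟩
  total (total (𝟙-balanced x) ∘ elements) (symmetricChains n)             ≤⟨ total-mono chainwise ⟩
  total (total (𝟙-rank ⌊ n /2⌋) ∘ elements) (symmetricChains n)           ≡⟨ total-symmetricChains n _ ⟨
  total (𝟙-rank ⌊ n /2⌋) (allSigns n)                                     ≡⟨ total-𝟙-rank n ⌊ n /2⌋ ⟩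
  n C ⌊ n /2⌋                                                             ∎
  where
  open ≤-Reasoning
  chainwise : All (λ c → total (𝟙-balanced x) (elements c) ≤ total (𝟙-rank ⌊ n /2⌋) (elements c))
                  (symmetricChains n)
  chainwise = All.map (λ { {c} s@(_ , c-cover , _) →
    ≤-trans (hits-≤1 (λ ε → signedSum ε x) (signedSum-⋖ x pos) (ℤ.+ 0) c-cover)
            (symmetricChain-meets-middle c s) }) (symmetricChains-symmetric n)

-- Double factorials and central binomial coefficients

!!-even : ∀ m → (2 * m) !! ≡ 2 ^ m * m !
!!-even zero    = refl
!!-even (suc m) = begin
  (2 * suc m) !!            ≡⟨ cong _!! (*-suc 2 m) ⟩
  (2 + 2 * m) * (2 * m) !!  ≡⟨ cong ((2 + 2 * m) *_) (!!-even m) ⟩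
  (2 + 2 * m) * (2 ^ m * m !) ≡⟨ regroup m (2 ^ m) (m !) ⟩
  2 ^ suc m * suc m !       ∎
  where
  open ≡-Reasoning
  regroup : ∀ m p f → (2 + 2 * m) * (p * f) ≡ (2 * p) * (suc m * f)
  regroup = solve-∀

!!*suc!!≡suc! : ∀ n → n !! * suc n !! ≡ suc n !
!!*suc!!≡suc! zero    = refl
!!*suc!!≡suc! (suc n) = begin
  suc n !! * (suc (suc n) * n !!) ≡⟨ regroup (suc n !!) (suc (suc n)) (n !!) ⟩
  suc (suc n) * (n !! * suc n !!) ≡⟨ cong (suc (suc n) *_) (!!*suc!!≡suc! n) ⟩
  suc (suc n) * suc n !           ∎
  where
  open ≡-Reasoning
  regroup : ∀ a b c → a * (b * c) ≡ b * (c * a)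
  regroup = solve-∀

pred!!*!!≡! : ∀ n → (n ∸ 1) !! * n !! ≡ n !
pred!!*!!≡! zero    = refl
pred!!*!!≡! (suc n) = !!*suc!!≡suc! n

!!-nonZero : ∀ n → NonZero (n !!)
!!-nonZero zero          = _
!!-nonZero (suc zero)    = _
!!-nonZero (suc (suc n)) = m*n≢0 (suc (suc n)) (n !!) {{_}} {{ !!-nonZero n }}

nCk*k!*[n∸k]!≡n! : ∀ {n k} → k ≤ n → (n C k) * (k ! * (n ∸ k) !) ≡ n !
nCk*k!*[n∸k]!≡n! {n} {k} k≤n = trans (cong (_* (k ! * (n ∸ k) !)) (nCk≡n!/k![n-k]! k≤n))
  (m/n*n≡m {{k !* (n ∸ k) !≢0}} (k![n∸k]!∣n! k≤n))

0<nCk : ∀ {n k} → k ≤ n → 0 < n C k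
0<nCk {n} {k} k≤n = n≢0⇒n>0 λ nCk≡0 →
  m<n⇒n≢0 (1≤n! n) (trans (sym (nCk*k!*[n∸k]!≡n! k≤n)) (cong (_* (k ! * (n ∸ k) !)) nCk≡0))

2m∸m≡m : ∀ m → 2 * m ∸ m ≡ m
2m∸m≡m m = trans (cong (λ s → m + s ∸ m) (+-identityʳ m)) (m+n∸m≡n m m)

4^m≡2^m*2^m : ∀ m → 4 ^ m ≡ 2 ^ m * 2 ^ m
4^m≡2^m*2^m zero    = refl
4^m≡2^m*2^m (suc m) = trans (cong (4 *_) (4^m≡2^m*2^m m)) (regroup (2 ^ m))
  where
  regroup : ∀ p → 4 * (p * p) ≡ (2 * p) * (2 * p)
  regroup = solve-∀

4^m*odd!!≡central*even!! : ∀ m → 4 ^ m * (2 * m ∸ 1) !! ≡ ((2 * m) C m) * (2 * m) !!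
4^m*odd!!≡central*even!! m = *-cancelʳ-≡ _ _ E {{ !!-nonZero (2 * m) }} (begin
  (4 ^ m * O) * E                        ≡⟨ *-assoc (4 ^ m) O E ⟩
  4 ^ m * (O * E)                        ≡⟨ cong₂ _*_ (4^m≡2^m*2^m m) (pred!!*!!≡! (2 * m)) ⟩
  (2 ^ m * 2 ^ m) * (2 * m) !            ≡⟨ cong ((2 ^ m * 2 ^ m) *_) central ⟨
  (2 ^ m * 2 ^ m) * (c * (m ! * m !))    ≡⟨ regroup (2 ^ m) c (m !) ⟩
  (c * (2 ^ m * m !)) * (2 ^ m * m !)    ≡⟨ cong (λ e → (c * e) * e) (!!-even m) ⟨
  (c * E) * E                            ∎)
  where
  open ≡-Reasoning
  O = (2 * m ∸ 1) !!
  E = (2 * m) !!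
  c = (2 * m) C m
  central : c * (m ! * m !) ≡ (2 * m) !
  central = subst (λ s → c * (m ! * s !) ≡ (2 * m) !) (2m∸m≡m m)
    (nCk*k!*[n∸k]!≡n! (subst (_≤ 2 * m) (2m∸m≡m m) (m∸n≤m (2 * m) m)))
  regroup : ∀ p c f → (p * p) * (c * (f * f)) ≡ (c * (p * f)) * (p * f)
  regroup = solve-∀

central≡2*C : ∀ m → (2 * suc m) C suc m ≡ 2 * ((2 * suc m ∸ 1) C suc m)
central≡2*C m = begin
  (2 * suc m) C suc m                        ≡⟨ cong (_C suc m) (*-suc 2 m) ⟩
  suc (suc (2 * m)) C suc m                  ≡⟨ nCk+nC[k+1]≡[n+1]C[k+1] (suc (2 * m)) m ⟨
  suc (2 * m) C m + suc (2 * m) C suc m      ≡⟨ cong (_+ suc (2 * m) C suc m) reflect ⟩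
  suc (2 * m) C suc m + suc (2 * m) C suc m  ≡⟨ cong (suc (2 * m) C suc m +_) (+-identityʳ _) ⟨
  2 * (suc (2 * m) C suc m)                  ≡⟨ cong (λ s → 2 * ((s ∸ 1) C suc m)) (*-suc 2 m) ⟨
  2 * ((2 * suc m ∸ 1) C suc m)              ∎
  where
  open ≡-Reasoning
  complement : suc (2 * m) ∸ m ≡ suc m
  complement = trans (cong (λ s → suc (m + s) ∸ m) (+-identityʳ m))
    (trans (cong (_∸ m) (sym (+-suc m m))) (m+n∸m≡n m (suc m)))
  reflect : suc (2 * m) C m ≡ suc (2 * m) C suc m
  reflect = trans (nCk≡nC[n∸k] (≤-trans (m≤m+n m (m + 0)) (n≤1+n _))) (cong (suc (2 * m) C_) complement)

ES²≤central-binomial : ∀ m (x : Fin m → ℕ) → (∀ i → 0 < x i) → ES m x ^ 2 ≤ (2 * m) C m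
ES²≤central-binomial m x pos = begin
  ES m x ^ 2               ≡⟨ cong (ES m x *_) (*-identityʳ (ES m x)) ⟩
  ES m x * ES m x          ≤⟨ ES-*-≤-ES-++ x x ⟩
  ES (m + m) (x ++ᶠ x)     ≤⟨ littlewood-offord (m + m) (x ++ᶠ x) (Allᶠ.++⁺ (0 <_) pos pos) ⟩
  (m + m) C ⌊ m + m /2⌋    ≡⟨ cong₂ _C_ (cong (m +_) (+-identityʳ m)) (n≡⌊n+n/2⌋ m) ⟨
  (2 * m) C m              ∎
  where open ≤-Reasoning

theorem3 : ((m : ℕ) → 1 ≤ m → (x : Fin m → ℕ) → (∀ i → 0 < x i) →
      ((ES m x ^ 2) * ((2 * m) !!) ≤ (4 ^ m) * ((2 * m ∸ 1) !!))
      × (ES m x ^ 2 ≤ 2 * ((2 * m ∸ 1) C m))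
      × ((4 ^ m) * ((2 * m ∸ 1) !!) ≡ 2 * ((2 * m ∸ 1) C m) * ((2 * m) !!)))
    × ((m : ℕ) → 1 ≤ m → J m ^ 2 ≤ 2 * ((2 * m + 1) C (m + 1)))
theorem3 = ES-bounds , J-bound
  where
  ES-bounds : (m : ℕ) → 1 ≤ m → (x : Fin m → ℕ) → (∀ i → 0 < x i) →
      (ES m x ^ 2 * (2 * m) !! ≤ 4 ^ m * (2 * m ∸ 1) !!)
      × (ES m x ^ 2 ≤ 2 * ((2 * m ∸ 1) C m))
      × (4 ^ m * (2 * m ∸ 1) !! ≡ 2 * ((2 * m ∸ 1) C m) * (2 * m) !!)
  ES-bounds (suc m) _ x pos = weighted , bound , identity
    where
    bound : ES (suc m) x ^ 2 ≤ 2 * ((2 * suc m ∸ 1) C suc m)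
    bound = subst (ES (suc m) x ^ 2 ≤_) (central≡2*C m) (ES²≤central-binomial (suc m) x pos)
    identity : 4 ^ suc m * (2 * suc m ∸ 1) !! ≡ 2 * ((2 * suc m ∸ 1) C suc m) * (2 * suc m) !!
    identity = trans (4^m*odd!!≡central*even!! (suc m)) (cong (_* (2 * suc m) !!) (central≡2*C m))
    weighted : ES (suc m) x ^ 2 * (2 * suc m) !! ≤ 4 ^ suc m * (2 * suc m ∸ 1) !!
    weighted = subst (ES (suc m) x ^ 2 * (2 * suc m) !! ≤_) (sym identity) (*-monoˡ-≤ ((2 * suc m) !!) bound)
  J-bound : (m : ℕ) → 1 ≤ m → J m ^ 2 ≤ 2 * ((2 * m + 1) C (m + 1))
  J-bound m _ = subst₂ (λ a b → J m ^ 2 ≤ 2 * (a C b))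
    (trans (cong (_∸ 1) (*-suc 2 m)) (+-comm 1 (2 * m))) (+-comm 1 m)
    (subst (J m ^ 2 ≤_) (central≡2*C m)
      (ES²≤central-binomial (suc m) (λ i → m C toℕ i) (λ i → 0<nCk (toℕ≤pred[n] i))))
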